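{- If $\mathcal{T}$ is a single-elimination tournament with at least $2$ players and $\sigma$ is a scoring system on $\mathcal{T}$ with distinct subset sums, then \[\dim(\mathcal{T},\sigma)=\max_{x\in M(\mathcal{T})}\Big(|P(x)|-\max_{u\in N^-(x)}|P(u)|\Big).\]
   Context: For a digraph, $N^+(v)$ is the set of out-neighbours of $v$ and $N^-(v)$ the set of in-neighbours; a sink has $N^+(v)=\emptyset$, a source has $N^-(v)=\emptyset$. A single-elimination tournament $\mathcal{T}$ is a finite digraph with: exactly one sink; $|N^+(v)|=1$ for every non-sink $v$; no directed cycles; and $|N^-(v)|\ne 1$ for every vertex $v$. Players $P(\mathcal{T})$ are the sources; matches $M(\mathcal{T})$ are the non-sources. A directed walk from $u_1$ to $u_t$ is a sequence $(u_1,\dots,u_t)$, $t\ge1$, with $u_{i+1}\in N^+(u_i)$; the player set $P(u)$ of a vertex $u$ is the set of players $a$ with a directed walk from $a$ to $u$. A bracket is a function $B:V(\mathcal{T})\to P(\mathcal{T})$ with $B(a)=a$ for every player $a$ and $B(x)\in\{B(u):u\in N^-(x)\}$ for every match $x$. A scoring system is a function $\sigma:M(\mathcal{T})\to\mathbb{R}_{>0}$; it has distinct subset sums if for any two sets of matches $M,M'$, $\sum_{x\in M}\sigma(x)=\sum_{x\in M'}\sigma(x)$ implies $M=M'$. $\mathrm{score}_\sigma(B,B')=\sum_{x\in M(\mathcal{T}):B(x)=B'(x)}\sigma(x)$. A set of brackets $\mathcal{B}$ is $\sigma$-resolving if for all pairs of distinct brackets $B,B'$ there is $B_i\in\mathcal{B}$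 with $\mathrm{score}_\sigma(B_i,B)\ne\mathrm{score}_\sigma(B_i,B')$; $\dim(\mathcal{T},\sigma)$ is the minimum size of a $\sigma$-resolving set. -}

module Defs where

open import Level using (Level; _⊔_; suc)
open import Data.Nat as ℕ using (ℕ; zero; _≤_; _∸_) renaming (_⊔_ to _⊔ℕ_)
open import Data.Bool using (Bool; true; false; _∧_; if_then_else_)
open import Data.Fin using (Fin; _≟_)
open import Data.Fin.Subset using (Subset; ∣_∣; inside; outside)
open import Data.Vec using (tabulate; lookup)
open import Data.List using (List; foldr; map; filterᵇ; allFin; length)
open import Data.List.Membership.Propositional using (_∈_)
open import Data.List.Relation.Unary.Unique.Propositional using (Unique)
open import Data.Product using (Σ; Σ-syntax; _×_; ∃; ∃-syntax)
open import Relation.Nullary using (¬_; ⌊_⌋)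
open import Relation.Binary using (Rel; IsStrictTotalOrder)
open import Relation.Binary.PropositionalEquality using (_≡_; _≢_)
open import Algebra.Bundles using (CommutativeMonoid)
open import Function.Bundles using (_⇔_)

-- The paper uses ℝ (with + , 0, <).
-- agda-stdlib has no reals, so we abstract over any commutative monoid
-- carrying a strict total order compatible with addition; ℝ is an
-- instance.

record OrderedCommMonoid (c ℓ ℓ' : Level) : Set (suc (c ⊔ ℓ ⊔ ℓ')) where
  field
    commutativeMonoid : CommutativeMonoid c ℓ
  open CommutativeMonoid commutativeMonoid public
  field
    _<_                 : Rel Carrier ℓ'
    isStrictTotalOrder  : IsStrictTotalOrder _≈_ _<_
    +-mono-<            : ∀ {x y} z → x < y → (x ∙ z) < (y ∙ z)

Digraph : ℕ → Set
Digraph n = Fin n → Fin n → Bool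

module _ {n : ℕ} (E : Digraph n) where

  outN : Fin n → Subset n
  outN v = tabulate (λ w → E v w)

  inN : Fin n → Subset n
  inN v = tabulate (λ u → E u v)

  IsSink : Fin n → Set
  IsSink v = ∣ outN v ∣ ≡ 0

  IsSource : Fin n → Set
  IsSource v = ∣ inN v ∣ ≡ 0

  data Walk : Fin n → Fin n → Set where
    here : ∀ {a} → Walk a a
    step : ∀ {a v u} → E a v ≡ true → Walk v u → Walk a u

  record IsSETournament : Set where
    field
      uniqueSink   : Σ[ s ∈ Fin n ] (IsSink s × (∀ v → IsSink v → v ≡ s))
      outDegreeOne : ∀ v → ¬ IsSink v → ∣ outN v ∣ ≡ 1
      acyclic      : ∀ u v → E u v ≡ true → ¬ Walk v u
      inDegreeNot1 : ∀ v → ∣ inN v ∣ ≢ 1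

  Player : Fin n → Set
  Player = IsSource

  Match : Fin n → Set
  Match v = ¬ IsSource v

  isMatch : Fin n → Bool
  isMatch v = if ⌊ ∣ inN v ∣ ℕ.≟ 0 ⌋ then false else true

  PlayerOf : Fin n → Fin n → Set
  PlayerOf u a = Player a × Walk a u

  record IsBracket (B : Fin n → Fin n) : Set where
    field
      toPlayer   : ∀ v → Player (B v)
      onPlayers  : ∀ a → Player a → B a ≡ a
      onMatches  : ∀ x → Match x →
                   Σ[ u ∈ Fin n ] (E u x ≡ true × B x ≡ B u)

  inList : Fin n → List (Fin n)
  inList x = filterᵇ (λ u → E u x) (allFin n)

  matchList : List (Fin n)
  matchList = filterᵇ isMatch (allFin n)

  module Scoring {c ℓ ℓ'} (R : OrderedCommMonoid c ℓ ℓ') where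
    open OrderedCommMonoid R

    -- a scoring system: values on matches are positive; the values at
    -- players are irrelevant (never used)
    IsScoring : (Fin n → Carrier) → Set ℓ'
    IsScoring σ = ∀ x → Match x → ε < σ x

    sumσ : (Fin n → Carrier) → Subset n → Carrier
    sumσ σ M = foldr (λ x acc → if lookup M x then σ x ∙ acc else acc)
                     ε (allFin n)

    SetOfMatches : Subset n → Set
    SetOfMatches M = ∀ x → lookup M x ≡ inside → Match x

    DistinctSubsetSums : (Fin n → Carrier) → Set ℓ
    DistinctSubsetSums σ = ∀ M M' → SetOfMatches M → SetOfMatches M' →
                           sumσ σ M ≈ sumσ σ M' → M ≡ M'

    score : (Fin n → Carrier) → (Fin n → Fin n) → (Fin n → Fin n) → Carrier
    score σ B B' = sumσ σ (tabulate (λ x → isMatch x ∧ ⌊ B x ≟ B' x ⌋))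

    IsResolving : (Fin n → Carrier) → (k : ℕ) → (Fin k → Fin n → Fin n) → Set (ℓ)
    IsResolving σ k Bs =
      (∀ i → IsBracket (Bs i)) ×
      (∀ B B' → IsBracket B → IsBracket B' → (∃[ v ] B v ≢ B' v) →
         ∃[ i ] ¬ (score σ (Bs i) B ≈ score σ (Bs i) B'))

    IsDim : (Fin n → Carrier) → ℕ → Set ℓ
    IsDim σ d = (Σ[ Bs ∈ (Fin d → Fin n → Fin n) ] IsResolving σ d Bs) ×
                (∀ k (Bs : Fin k → Fin n → Fin n) → IsResolving σ k Bs → d ≤ k)

HasSize : {n : ℕ} → (Fin n → Set) → ℕ → Set
HasSize {n} Q c = Σ[ l ∈ List (Fin n) ] (Unique l × (∀ a → (a ∈ l) ⇔ Q a) × length l ≡ c)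

maxℕ : List ℕ → ℕ
maxℕ = foldr _⊔ℕ_ 0

rhs : {n : ℕ} → Digraph n → (Fin n → ℕ) → ℕ
rhs E p = maxℕ (map (λ x → p x ∸ maxℕ (map p (inList E x))) (matchList E))

-- Call a player light at a match x if it plays in x but not in x's heavy child (a child
-- with the most players); x has p x ∸ p (heavy x) ≤ d light players. Labelling each player
-- by its position among the light players of the highest match at which it is light gives
-- labels below d that are injective on the light players of every match. The bracket Q i
-- lets the light player labelled i through wherever possible and otherwise advances the
-- heavy child's winner. By induction from the players upwards, a bracket B is determined by
-- the sets of matches on which it agrees with each Q i: if B's winner at x is light, some Q i
-- predicts it, and otherwise it comes from the heavy child. Distinct subset sums make these
-- sets readable from the scores. Conversely, given k < d brackets, at a match x attaining d
-- two distinct children each contain a player that none of them has winning x; two brackets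
-- differing only at x, with these two winners, receive identical scores from all k.

{-# OPTIONS --safe #-}
module Submission where

open import Defs
open import Level using (Level; 0ℓ)
open import Data.Nat using (ℕ; suc; _≤_; _<_; _∸_; _+_; z≤n; s≤s; _≤?_)
open import Data.Nat.Properties
  using (≤-reflexive; ≤-trans; <-trans; ≤-<-trans; <-≤-trans; ≤-antisym; <⇒≢; ≤∧≢⇒<; n≢0⇒n>0; n>0⇒n≢0;
         m≤m⊔n; m≤n⊔m; ⊔-lub; +-suc; m+n∸m≡n; m∸n≢0⇒n<m; ∸-monoʳ-≤; ≰⇒>; <⇒≱)
  renaming (_≟_ to _≟ℕ_)
open import Data.Fin as Fin using (Fin; toℕ; fromℕ<; _≟_)
open import Data.Fin.Properties using (any?; toℕ<n; toℕ-fromℕ<; toℕ-injective; injective⇒≤)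
open import Data.Fin.Induction using (spo-wellFounded)
open import Data.Fin.Subset using (Subset; ∣_∣; ⁅_⁆; Nonempty) renaming (_∈_ to _∈ₛ_)
open import Data.Fin.Subset.Properties
  using (nonempty?; Empty-unique; ∣⊥∣≡0; x∈p⇒∣p-x∣<∣p∣; x∈p∧x≢y⇒x∈p-y; x∈⁅x⁆; ∣⁅x⁆∣≡1; p⊆q⇒∣p∣≤∣q∣)
  renaming (_∈?_ to _∈ₛ?_)
open import Data.Bool using (true; false; _∧_; T?)
open import Data.Bool.Properties using (T-≡; ∧-conicalˡ)
import Data.Bool as Bool
open import Data.Vec using (tabulate; lookup)
open import Data.Vec.Properties using (lookup∘tabulate; lookup⇒[]=; []=⇒lookup; ≡-dec; tabulate-cong)
open import Data.List as List using (List; []; _∷_; length; map; filter; allFin)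
open import Data.List.Properties using (length-tabulate)
open import Data.List.Extrema.Nat using (argmax; argmax-all; f[⊥]≤f[argmax]; f[xs]≤f[argmax])
open import Data.List.Membership.Propositional using (_∈_; find; lose)
open import Data.List.Membership.Propositional.Properties using (∈-lookup; ∈-filter⁺; ∈-filter⁻; ∈-allFin; ∈-tabulate⁺)
open import Data.List.Relation.Binary.Subset.Propositional using (_⊆_)
open import Data.List.Relation.Unary.Any as Any using (Any; here; there)
open import Data.List.Relation.Unary.Any.Properties using (lookup-index)
open import Data.List.Relation.Unary.All as All using (All)
open import Data.List.Relation.Unary.AllPairs using (_∷_)
open import Data.List.Relation.Unary.Unique.Propositional using (Unique)
open import Data.List.Relation.Unary.Unique.Propositional.Properties using (filter⁺)
import Data.List.Membership.DecPropositional as DecMembership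
open import Data.Product using (Σ; Σ-syntax; ∃-syntax; _×_; _,_; proj₁; proj₂)
open import Data.Sum using (_⊎_; inj₁; inj₂; [_,_]′)
open import Data.Empty using (⊥)
open import Function using (_∘_; id; _⇔_; Equivalence)
open import Induction.WellFounded as WF using (WellFounded; WfRec)
open import Relation.Binary using (Rel; Decidable; DecidableEquality; IsStrictPartialOrder)
open import Relation.Binary.PropositionalEquality
  using (_≡_; _≢_; refl; sym; trans; cong; cong₂; subst; resp₂; isEquivalence; ≢-sym; module ≡-Reasoning)
open import Relation.Nullary using (¬_; Dec; yes; no; ⌊_⌋; contradiction; ¬?)
open import Relation.Nullary.Decidable using (map′; _×-dec_; decidable-stable; toWitness; fromWitness; isYes≗does; dec-false)
import Relation.Unary
open Relation.Unary using (Pred)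

module _ {n : ℕ} where

  x∈p⇒0<∣p∣ : ∀ {p : Subset n} {x} → x ∈ₛ p → 0 < ∣ p ∣
  x∈p⇒0<∣p∣ x∈p = ≤-<-trans z≤n (x∈p⇒∣p-x∣<∣p∣ x∈p)

  x∈p∧y∈p∧x≢y⇒1<∣p∣ : ∀ {p : Subset n} {x y} → x ∈ₛ p → y ∈ₛ p → x ≢ y → 1 < ∣ p ∣
  x∈p∧y∈p∧x≢y⇒1<∣p∣ x∈p y∈p x≢y =
    ≤-<-trans (x∈p⇒0<∣p∣ (x∈p∧x≢y⇒x∈p-y y∈p (≢-sym x≢y))) (x∈p⇒∣p-x∣<∣p∣ x∈p)

  ∣p∣≢0⇒Nonempty : ∀ {p : Subset n} → ∣ p ∣ ≢ 0 → Nonempty p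
  ∣p∣≢0⇒Nonempty {p} ∣p∣≢0 with nonempty? p
  ... | yes ne = ne
  ... | no ¬ne = contradiction (trans (cong ∣_∣ (Empty-unique ¬ne)) (∣⊥∣≡0 n)) ∣p∣≢0

  1<∣p∣⇒∃∈≢ : ∀ {p : Subset n} → 1 < ∣ p ∣ → ∀ x → ∃[ y ] (y ∈ₛ p × y ≢ x)
  1<∣p∣⇒∃∈≢ {p} 1<∣p∣ x with any? (λ y → y ∈ₛ? p ×-dec ¬? (y ≟ x))
  ... | yes found = found
  ... | no none = contradiction (≤-trans (p⊆q⇒∣p∣≤∣q∣ p⊆⁅x⁆) (≤-reflexive (∣⁅x⁆∣≡1 x))) (<⇒≱ 1<∣p∣)
    where
    p⊆⁅x⁆ : ∀ {y} → y ∈ₛ p → y ∈ₛ ⁅ x ⁆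
    p⊆⁅x⁆ {y} y∈p with y ≟ x
    ... | yes refl = x∈⁅x⁆ x
    ... | no y≢x = contradiction (y , y∈p , y≢x) none

module _ {A : Set} where

  lookup-injective : ∀ {xs : List A} → Unique xs → ∀ i j →
                     List.lookup xs i ≡ List.lookup xs j → i ≡ j
  lookup-injective (_ ∷ _) Fin.zero Fin.zero _ = refl
  lookup-injective (x∉ ∷ _) Fin.zero (Fin.suc j) eq = contradiction eq (All.lookup x∉ (∈-lookup j))
  lookup-injective (x∉ ∷ _) (Fin.suc i) Fin.zero eq = contradiction (sym eq) (All.lookup x∉ (∈-lookup i))
  lookup-injective (_ ∷ u) (Fin.suc i) (Fin.suc j) eq = cong Fin.suc (lookup-injective u i j eq)

  Unique∧⊆⇒length≤ : ∀ {xs ys : List A} → Unique xs → xs ⊆ ys → length xs ≤ length ys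
  Unique∧⊆⇒length≤ {xs} {ys} u xs⊆ys = injective⇒≤ {f = position} position-injective
    where
    position : Fin (length xs) → Fin (length ys)
    position i = Any.index (xs⊆ys (∈-lookup i))
    position-injective : ∀ {i j} → position i ≡ position j → i ≡ j
    position-injective {i} {j} eq = lookup-injective u i j (begin
      List.lookup xs i                ≡⟨ lookup-index (xs⊆ys (∈-lookup i)) ⟩
      List.lookup ys (position i)     ≡⟨ cong (List.lookup ys) eq ⟩
      List.lookup ys (position j)     ≡⟨ lookup-index (xs⊆ys (∈-lookup j)) ⟨
      List.lookup xs j                ∎)
      where open ≡-Reasoning

  length-filter+length-filter-∁ : ∀ {P : Pred A 0ℓ} (P? : Relation.Unary.Decidable P) xs →
                                  length (filter P? xs) + length (filter (¬? ∘ P?) xs) ≡ length xs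
  length-filter+length-filter-∁ P? [] = refl
  length-filter+length-filter-∁ P? (x ∷ xs) with P? x
  ... | yes _ = cong suc (length-filter+length-filter-∁ P? xs)
  ... | no _ = trans (+-suc _ _) (cong suc (length-filter+length-filter-∁ P? xs))

  maxℕ-ub : ∀ (f : A → ℕ) {xs x} → x ∈ xs → f x ≤ maxℕ (map f xs)
  maxℕ-ub f {y ∷ _} (here refl) = m≤m⊔n (f y) _
  maxℕ-ub f {y ∷ _} (there x∈) = ≤-trans (maxℕ-ub f x∈) (m≤n⊔m (f y) _)

  maxℕ-lub : ∀ (f : A → ℕ) xs {b} → (∀ {x} → x ∈ xs → f x ≤ b) → maxℕ (map f xs) ≤ b
  maxℕ-lub f [] _ = z≤n
  maxℕ-lub f (x ∷ xs) ub = ⊔-lub (ub (here refl)) (maxℕ-lub f xs (ub ∘ there))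

  argmax⁺ : (A → ℕ) → A → List A → A
  argmax⁺ f d [] = d
  argmax⁺ f d (x ∷ xs) = argmax f x xs

  module _ (f : A → ℕ) (d : A) where

    argmax⁺-∈ : ∀ {xs y} → y ∈ xs → argmax⁺ f d xs ∈ xs
    argmax⁺-∈ {x ∷ xs} _ = argmax-all f {P = _∈ x ∷ xs} (here refl) (All.tabulate there)

    argmax⁺-max : ∀ {xs y} → y ∈ xs → f y ≤ f (argmax⁺ f d xs)
    argmax⁺-max {x ∷ xs} (here refl) = f[⊥]≤f[argmax] {f = f} x xs
    argmax⁺-max {x ∷ xs} (there y∈) = All.lookup (f[xs]≤f[argmax] {f = f} x xs) y∈

    argmax⁺≡maxℕ : ∀ {xs y} → y ∈ xs → f (argmax⁺ f d xs) ≡ maxℕ (map f xs)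
    argmax⁺≡maxℕ {xs} y∈ =
      ≤-antisym (maxℕ-ub f (argmax⁺-∈ y∈)) (maxℕ-lub f xs argmax⁺-max)

  maxℕ-attained : ∀ (f : A → ℕ) xs → 0 < maxℕ (map f xs) → ∃[ x ] (x ∈ xs × f x ≡ maxℕ (map f xs))
  maxℕ-attained f (x ∷ xs) _ = argmax⁺ f x (x ∷ xs) , argmax⁺-∈ f x (here refl) , argmax⁺≡maxℕ f x {x ∷ xs} (here refl)

module _ {A : Set} (_≟ᴬ_ : DecidableEquality A) where
  open DecMembership _≟ᴬ_ using (_∈?_)

  position : A → List A → ℕ
  position a xs with a ∈? xs
  ... | yes a∈ = toℕ (Any.index a∈)
  ... | no _ = 0

  position-index : ∀ {a xs} → a ∈ xs → ∃[ a∈ ] position a xs ≡ toℕ (Any.index a∈)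
  position-index {a} {xs} a∈ with a ∈? xs
  ... | yes a∈′ = a∈′ , refl
  ... | no a∉ = contradiction a∈ a∉

  position-< : ∀ {a xs} → a ∈ xs → position a xs < length xs
  position-< a∈ with position-index a∈
  ... | a∈′ , eq = subst (_< _) (sym eq) (toℕ<n (Any.index a∈′))

  position-injective : ∀ {a b xs} → a ∈ xs → b ∈ xs → position a xs ≡ position b xs → a ≡ b
  position-injective {xs = xs} a∈ b∈ eq with position-index a∈ | position-index b∈
  ... | a∈′ , eqa | b∈′ , eqb = begin
    _                                   ≡⟨ lookup-index a∈′ ⟩
    List.lookup xs (Any.index a∈′)      ≡⟨ cong (List.lookup xs) (toℕ-injective (trans (sym eqa) (trans eq eqb))) ⟩
    List.lookup xs (Any.index b∈′)      ≡⟨ lookup-index b∈′ ⟨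
    _                                   ∎
    where open ≡-Reasoning

module _ {n : ℕ} {E : Digraph n} where

  isMatch≡true : ∀ {x} → Match E x → isMatch E x ≡ true
  isMatch≡true {x} m with ∣ inN E x ∣ ≟ℕ 0
  ... | yes src = contradiction src m
  ... | no _ = refl

  isMatch≡true⇒Match : ∀ {x} → isMatch E x ≡ true → Match E x
  isMatch≡true⇒Match {x} eq with ∣ inN E x ∣ ≟ℕ 0
  isMatch≡true⇒Match () | yes _
  ... | no m = m

  Match⇒∈matchList : ∀ {x} → Match E x → x ∈ matchList E
  Match⇒∈matchList {x} m =
    ∈-filter⁺ (T? ∘ isMatch E) (∈-allFin x) (Equivalence.from T-≡ (isMatch≡true m))

  ∈matchList⇒Match : ∀ {x} → x ∈ matchList E → Match E x
  ∈matchList⇒Match {x} x∈ =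
    isMatch≡true⇒Match (Equivalence.to T-≡ (proj₂ (∈-filter⁻ (T? ∘ isMatch E) {xs = allFin n} x∈)))

agreement : ∀ {n} → Digraph n → (Fin n → Fin n) → (Fin n → Fin n) → Subset n
agreement E B B′ = tabulate (λ x → isMatch E x ∧ ⌊ B x ≟ B′ x ⌋)

module Agreement {c ℓ ℓ′ : Level} (R : OrderedCommMonoid c ℓ ℓ′) {n : ℕ} (E : Digraph n)
                 (σ : Fin n → OrderedCommMonoid.Carrier R) where
  open OrderedCommMonoid R using (_≈_; reflexive)
  open Scoring E R

  private
    _≟ₛ_ : DecidableEquality (Subset n)
    _≟ₛ_ = ≡-dec Bool._≟_

  agreement-SetOfMatches : ∀ B B′ → SetOfMatches (agreement E B B′)
  agreement-SetOfMatches B B′ x eq =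
    isMatch≡true⇒Match {E = E} (∧-conicalˡ _ _ (trans (sym (lookup∘tabulate _ x)) eq))

  ≈-score⇒≡-agreement : DistinctSubsetSums σ → ∀ {B₀ B B′} →
                        score σ B₀ B ≈ score σ B₀ B′ → agreement E B₀ B ≡ agreement E B₀ B′
  ≈-score⇒≡-agreement dss {B₀} {B} {B′} =
    dss _ _ (agreement-SetOfMatches B₀ B) (agreement-SetOfMatches B₀ B′)

  agreement-transport : ∀ {B₀ B B′ x} → agreement E B₀ B ≡ agreement E B₀ B′ → Match E x →
                        B₀ x ≡ B x → B₀ x ≡ B′ x
  agreement-transport {B₀} {B} {B′} {x} eq m B₀x≡Bx = toWitness (Equivalence.from T-≡ (begin
    ⌊ B₀ x ≟ B′ x ⌋                ≡⟨ at B′ ⟨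
    lookup (agreement E B₀ B′) x   ≡⟨ cong (λ s → lookup s x) eq ⟨
    lookup (agreement E B₀ B) x    ≡⟨ at B ⟩
    ⌊ B₀ x ≟ B x ⌋                 ≡⟨ Equivalence.to T-≡ (fromWitness B₀x≡Bx) ⟩
    true                           ∎))
    where
    open ≡-Reasoning
    at : ∀ B → lookup (agreement E B₀ B) x ≡ ⌊ B₀ x ≟ B x ⌋
    at B = trans (lookup∘tabulate _ x) (cong (_∧ _) (isMatch≡true {E = E} m))

  resolving-if-agreements-separate :
    DistinctSubsetSums σ → ∀ {k} (Bs : Fin k → Fin n → Fin n) → (∀ i → IsBracket E (Bs i)) →
    (∀ {B B′} → IsBracket E B → IsBracket E B′ → (∀ i → agreement E (Bs i) B ≡ agreement E (Bs i) B′) →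
       ∀ v → B v ≡ B′ v) →
    IsResolving σ k Bs
  resolving-if-agreements-separate dss {k} Bs isBs separate = isBs , resolve
    where
    resolve : ∀ B B′ → IsBracket E B → IsBracket E B′ → (∃[ v ] B v ≢ B′ v) →
              ∃[ i ] ¬ (score σ (Bs i) B ≈ score σ (Bs i) B′)
    resolve B B′ isB isB′ (v , Bv≢B′v)
      with any? {n = k} (λ i → ¬? (agreement E (Bs i) B ≟ₛ agreement E (Bs i) B′))
    ... | yes (i , ≢agreement) = i , ≢agreement ∘ ≈-score⇒≡-agreement dss
    ... | no none = contradiction (separate isB isB′ ≡agreement v) Bv≢B′v
      where
      ≡agreement : ∀ i → agreement E (Bs i) B ≡ agreement E (Bs i) B′
      ≡agreement i = decidable-stable (agreement E (Bs i) B ≟ₛ agreement E (Bs i) B′)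
                                      (λ ≢agreement → none (i , ≢agreement))

  ¬resolving-if-agreements-equal :
    ∀ {k} {Bs : Fin k → Fin n → Fin n} → IsResolving σ k Bs → ∀ {B B′} →
    IsBracket E B → IsBracket E B′ → (∃[ v ] B v ≢ B′ v) →
    (∀ i → agreement E (Bs i) B ≡ agreement E (Bs i) B′) → ⊥
  ¬resolving-if-agreements-equal (_ , resolve) isB isB′ B≢B′ ≡agreement
    with resolve _ _ isB isB′ B≢B′
  ... | i , ≉score = ≉score (reflexive (cong (sumσ σ) (≡agreement i)))

module Tournament {n : ℕ} (E : Digraph n) (T : IsSETournament E) where
  open IsSETournament T

  infix 4 _◁_
  _◁_ : Rel (Fin n) 0ℓ
  u ◁ x = E u x ≡ true

  _◁?_ : Decidable _◁_
  u ◁? x = E u x Bool.≟ true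

  ◁⇒∈inN : ∀ {u x} → u ◁ x → u ∈ₛ inN E x
  ◁⇒∈inN {u} e = lookup⇒[]= u _ (trans (lookup∘tabulate _ u) e)

  ◁⇒∈outN : ∀ {u x} → u ◁ x → x ∈ₛ outN E u
  ◁⇒∈outN {x = x} e = lookup⇒[]= x _ (trans (lookup∘tabulate _ x) e)

  ∈inN⇒◁ : ∀ {u x} → u ∈ₛ inN E x → u ◁ x
  ∈inN⇒◁ {u} u∈ = trans (sym (lookup∘tabulate _ u)) ([]=⇒lookup u∈)

  isSource? : ∀ v → Dec (IsSource E v)
  isSource? v = ∣ inN E v ∣ ≟ℕ 0

  source⊎match : ∀ v → IsSource E v ⊎ Match E v
  source⊎match v with isSource? v
  ... | yes src = inj₁ src
  ... | no m = inj₂ m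

  ◁⇒Match : ∀ {u x} → u ◁ x → Match E x
  ◁⇒Match e = <⇒≢ (x∈p⇒0<∣p∣ (◁⇒∈inN e)) ∘ sym

  ◁-functional : ∀ {v w w′} → v ◁ w → v ◁ w′ → w ≡ w′
  ◁-functional {v} {w} {w′} e e′ with w ≟ w′
  ... | yes w≡w′ = w≡w′
  ... | no w≢w′ = contradiction (outDegreeOne v notSink)
                    (<⇒≢ (x∈p∧y∈p∧x≢y⇒1<∣p∣ (◁⇒∈outN e) (◁⇒∈outN e′) w≢w′) ∘ sym)
    where
    notSink : ¬ IsSink E v
    notSink = <⇒≢ (x∈p⇒0<∣p∣ (◁⇒∈outN e)) ∘ sym

  Match⇒∃◁ : ∀ {x} → Match E x → ∃[ u ] u ◁ x
  Match⇒∃◁ m with ∣p∣≢0⇒Nonempty m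
  ... | u , u∈ = u , ∈inN⇒◁ u∈

  Match⇒∃◁≢ : ∀ {x} → Match E x → ∀ u → ∃[ u′ ] (u′ ◁ x × u′ ≢ u)
  Match⇒∃◁≢ {x} m u with 1<∣p∣⇒∃∈≢ (≤∧≢⇒< (n≢0⇒n>0 m) (≢-sym (inDegreeNot1 x))) u
  ... | u′ , u′∈ , u′≢u = u′ , ∈inN⇒◁ u′∈ , u′≢u

  ◁⇒Walk : ∀ {u x} → u ◁ x → Walk E u x
  ◁⇒Walk e = step e here

  _++ʷ_ : ∀ {a b c} → Walk E a b → Walk E b c → Walk E a c
  here ++ʷ ρ = ρ
  step e π ++ʷ ρ = step e (π ++ʷ ρ)

  unsnocʷ : ∀ {a y} → Walk E a y → a ≡ y ⊎ ∃[ u ] (Walk E a u × u ◁ y)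
  unsnocʷ here = inj₁ refl
  unsnocʷ (step e π) with unsnocʷ π
  ... | inj₁ refl = inj₂ (_ , here , e)
  ... | inj₂ (u , π′ , e′) = inj₂ (u , step e π′ , e′)

  -- every vertex has out-degree at most one, so the walks leaving a vertex form a chain
  Walk-comparable : ∀ {a v w} → Walk E a v → Walk E a w → Walk E v w ⊎ Walk E w v
  Walk-comparable here ρ = inj₁ ρ
  Walk-comparable (step e π) here = inj₂ (step e π)
  Walk-comparable (step e π) (step e′ ρ) with ◁-functional e e′
  ... | refl = Walk-comparable π ρ

  Walk-source : ∀ {a y} → IsSource E y → Walk E a y → a ≡ y
  Walk-source src π with unsnocʷ π
  ... | inj₁ a≡y = a≡y
  ... | inj₂ (_ , _ , e) = contradiction src (◁⇒Match e)

  ◁-acyclic : ∀ {u x} → u ◁ x → ¬ Walk E x u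
  ◁-acyclic = acyclic _ _

  infix 4 _⊏_
  _⊏_ : Rel (Fin n) 0ℓ
  u ⊏ x = ∃[ v ] (u ◁ v × Walk E v x)

  ⊏-isStrictPartialOrder : IsStrictPartialOrder _≡_ _⊏_
  ⊏-isStrictPartialOrder = record
    { isEquivalence = isEquivalence
    ; irrefl = λ { refl (_ , e , π) → ◁-acyclic e π }
    ; trans = λ { (_ , e , π) (_ , e′ , ρ) → _ , e , π ++ʷ step e′ ρ }
    ; <-resp-≈ = resp₂ _⊏_
    }

  ◁-wellFounded : WellFounded _◁_
  ◁-wellFounded = WF.Subrelation.wellFounded (λ e → _ , e , here) (spo-wellFounded ⊏-isStrictPartialOrder)

  open WF.All ◁-wellFounded 0ℓ public using () renaming (wfRec to ◁-induction)

module PlayerSets {n : ℕ} (E : Digraph n) (T : IsSETournament E)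
                  (p : Fin n → ℕ) (p-size : ∀ u → HasSize (PlayerOf E u) (p u)) where
  open Tournament E T public

  infix 4 _∈P_ _∈P?_
  _∈P_ : Fin n → Fin n → Set
  a ∈P u = PlayerOf E u a

  players : Fin n → List (Fin n)
  players u = proj₁ (p-size u)

  players-unique : ∀ u → Unique (players u)
  players-unique u = proj₁ (proj₂ (p-size u))

  ∈players⇔∈P : ∀ {a u} → a ∈ players u ⇔ a ∈P u
  ∈players⇔∈P {a} {u} = proj₁ (proj₂ (proj₂ (p-size u))) a

  length-players : ∀ u → length (players u) ≡ p u
  length-players u = proj₂ (proj₂ (proj₂ (p-size u)))

  _∈P?_ : Decidable _∈P_
  a ∈P? u = map′ (Equivalence.to ∈players⇔∈P) (Equivalence.from ∈players⇔∈P) (a ∈? players u)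
    where open DecMembership _≟_ using (_∈?_)

  ∈P-walk : ∀ {a y z} → a ∈P y → Walk E y z → a ∈P z
  ∈P-walk (src , π) ρ = src , π ++ʷ ρ

  ∈P-◁ : ∀ {a u x} → a ∈P u → u ◁ x → a ∈P x
  ∈P-◁ a∈ e = ∈P-walk a∈ (◁⇒Walk e)

  ∈P-source : ∀ {a v} → IsSource E v → a ∈P v → a ≡ v
  ∈P-source src (_ , π) = Walk-source src π

  source-∈P : ∀ {v} → IsSource E v → v ∈P v
  source-∈P src = src , here

  ∈P-child : ∀ {a x} → Match E x → a ∈P x → ∃[ u ] (u ◁ x × a ∈P u)
  ∈P-child m (src , π) with unsnocʷ π
  ... | inj₁ refl = contradiction src m
  ... | inj₂ (u , π′ , e) = u , e , (src , π′)

  ∈P-comparable : ∀ {a y z} → a ∈P y → a ∈P z → Walk E y z ⊎ Walk E z y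
  ∈P-comparable (_ , π) (_ , ρ) = Walk-comparable π ρ

  ∈P-siblings : ∀ {a u u′ x} → u ◁ x → u′ ◁ x → u ≢ u′ → a ∈P u → ¬ a ∈P u′
  ∈P-siblings e e′ u≢u′ a∈u a∈u′ with ∈P-comparable a∈u a∈u′
  ... | inj₁ here = u≢u′ refl
  ... | inj₁ (step f π) rewrite ◁-functional f e = ◁-acyclic e′ π
  ... | inj₂ here = u≢u′ refl
  ... | inj₂ (step f π) rewrite ◁-functional f e′ = ◁-acyclic e π

  ∈P-nonempty : ∀ v → ∃[ a ] a ∈P v
  ∈P-nonempty = ◁-induction (λ v → ∃[ a ] a ∈P v) extend
    where
    extend : ∀ x → (∀ {y} → y ◁ x → ∃[ a ] a ∈P y) → ∃[ a ] a ∈P x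
    extend x ih with source⊎match x
    ... | inj₁ src = x , source-∈P src
    ... | inj₂ m with Match⇒∃◁ m
    ... | u , e = proj₁ (ih e) , ∈P-◁ (proj₂ (ih e)) e

  playersOutside : Fin n → Fin n → List (Fin n)
  playersOutside u x = filter (λ a → ¬? (a ∈P? u)) (players x)

  ∈playersOutside⁺ : ∀ {a u x} → a ∈P x → ¬ a ∈P u → a ∈ playersOutside u x
  ∈playersOutside⁺ a∈x a∉u = ∈-filter⁺ (λ a → ¬? (a ∈P? _)) (Equivalence.from ∈players⇔∈P a∈x) a∉u

  ∈playersOutside⁻ : ∀ {a u x} → a ∈ playersOutside u x → a ∈P x × ¬ a ∈P u
  ∈playersOutside⁻ {u = u} {x} a∈ with ∈-filter⁻ (λ a → ¬? (a ∈P? u)) {xs = players x} a∈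
  ... | a∈x , a∉u = Equivalence.to ∈players⇔∈P a∈x , a∉u

  playersOutside-unique : ∀ u x → Unique (playersOutside u x)
  playersOutside-unique u x = filter⁺ (λ a → ¬? (a ∈P? u)) (players-unique x)

  length-playersOutside : ∀ {u x} → u ◁ x → length (playersOutside u x) ≡ p x ∸ p u
  length-playersOutside {u} {x} e = begin
    length (playersOutside u x)                          ≡⟨ m+n∸m≡n (length playersInside) _ ⟨
    length playersInside + length (playersOutside u x) ∸ length playersInside
                                                         ≡⟨ cong₂ _∸_ split length-playersInside ⟩
    p x ∸ p u                                            ∎
    where
    open ≡-Reasoning
    playersInside : List (Fin n)
    playersInside = filter (_∈P? u) (players x)
    split : length playersInside + length (playersOutside u x) ≡ p x
    split = trans (length-filter+length-filter-∁ (_∈P? u) (players x)) (length-players x)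
    inside⊆players : playersInside ⊆ players u
    inside⊆players a∈ = Equivalence.from ∈players⇔∈P (proj₂ (∈-filter⁻ (_∈P? u) {xs = players x} a∈))
    players⊆inside : players u ⊆ playersInside
    players⊆inside a∈ = ∈-filter⁺ (_∈P? u) (Equivalence.from ∈players⇔∈P (∈P-◁ a∈u e)) a∈u
      where a∈u = Equivalence.to ∈players⇔∈P a∈
    length-playersInside : length playersInside ≡ p u
    length-playersInside = ≤-antisym
      (≤-trans (Unique∧⊆⇒length≤ (filter⁺ (_∈P? u) (players-unique x)) inside⊆players)
               (≤-reflexive (length-players u)))
      (≤-trans (≤-reflexive (sym (length-players u)))
               (Unique∧⊆⇒length≤ (players-unique u) players⊆inside))

  p-◁ : ∀ {u x} → u ◁ x → p u < p x
  p-◁ {u} e with Match⇒∃◁≢ (◁⇒Match e) u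
  ... | u′ , e′ , u′≢u with ∈P-nonempty u′
  ... | a , a∈u′ = m∸n≢0⇒n<m (n>0⇒n≢0 (subst (0 <_) (length-playersOutside e) (∈⇒0<length a∉u)))
    where
    a∉u : a ∈ playersOutside u _
    a∉u = ∈playersOutside⁺ (∈P-◁ a∈u′ e′) (∈P-siblings e′ e u′≢u a∈u′)
    ∈⇒0<length : ∀ {a : Fin n} {xs} → a ∈ xs → 0 < length xs
    ∈⇒0<length {xs = _ ∷ _} _ = s≤s z≤n

  p-walk : ∀ {y z} → Walk E y z → y ≡ z ⊎ p y < p z
  p-walk here = inj₁ refl
  p-walk (step e π) with p-walk π
  ... | inj₁ refl = inj₂ (p-◁ e)
  ... | inj₂ lt = inj₂ (<-trans (p-◁ e) lt)

  ∈P-p-injective : ∀ {a y z} → a ∈P y → a ∈P z → p y ≡ p z → y ≡ z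
  ∈P-p-injective a∈y a∈z eq with ∈P-comparable a∈y a∈z
  ... | inj₁ π = [ id , (λ lt → contradiction eq (<⇒≢ lt)) ]′ (p-walk π)
  ... | inj₂ π = [ sym , (λ lt → contradiction (sym eq) (<⇒≢ lt)) ]′ (p-walk π)

module HeavyChild {n : ℕ} (E : Digraph n) (T : IsSETournament E)
                  (p : Fin n → ℕ) (p-size : ∀ u → HasSize (PlayerOf E u) (p u)) where
  open PlayerSets E T p p-size public

  ◁⇒∈inList : ∀ {u x} → u ◁ x → u ∈ inList E x
  ◁⇒∈inList {u} {x} e = ∈-filter⁺ (λ w → T? (E w x)) (∈-allFin u) (Equivalence.from T-≡ e)

  ∈inList⇒◁ : ∀ {u x} → u ∈ inList E x → u ◁ x
  ∈inList⇒◁ {u} {x} u∈ = Equivalence.to T-≡ (proj₂ (∈-filter⁻ (λ w → T? (E w x)) {xs = allFin n} u∈))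

  heavy : Fin n → Fin n
  heavy x = argmax⁺ p x (inList E x)

  heavy-◁ : ∀ {x} → Match E x → heavy x ◁ x
  heavy-◁ {x} m = ∈inList⇒◁ (argmax⁺-∈ p x (◁⇒∈inList (proj₂ (Match⇒∃◁ m))))

  p≤p-heavy : ∀ {u x} → u ◁ x → p u ≤ p (heavy x)
  p≤p-heavy {x = x} e = argmax⁺-max p x (◁⇒∈inList e)

  module _ {P : Pred (Fin n) 0ℓ} (P? : Relation.Unary.Decidable P) where

    childSuchThat : Fin n → Fin n
    childSuchThat y with Any.any? P? (inList E y)
    ... | yes found = proj₁ (find found)
    ... | no _ = heavy y

    childSuchThat-◁ : ∀ {y} → Match E y → childSuchThat y ◁ y
    childSuchThat-◁ {y} m with Any.any? P? (inList E y)
    ... | yes found = ∈inList⇒◁ (proj₁ (proj₂ (find found)))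
    ... | no _ = heavy-◁ m

    childSuchThat-satisfies : ∀ {u y} → u ◁ y → P u → P (childSuchThat y)
    childSuchThat-satisfies {y = y} e Pu with Any.any? P? (inList E y)
    ... | yes found = proj₂ (proj₂ (find found))
    ... | no none = contradiction (lose (◁⇒∈inList e) Pu) none

  towards : Fin n → Fin n → Fin n
  towards y a = childSuchThat (a ∈P?_) y

  towards-∈P : ∀ {a y} → Match E y → a ∈P y → a ∈P towards y a
  towards-∈P {a} m a∈ with ∈P-child m a∈
  ... | _ , e , a∈u = childSuchThat-satisfies (a ∈P?_) e a∈u

  avoiding : Fin n → Fin n → Fin n
  avoiding y z = childSuchThat (λ u → ¬? (u ≟ z)) y

  avoiding-≢ : ∀ {y z} → Match E y → avoiding y z ≢ z
  avoiding-≢ {z = z} m with Match⇒∃◁≢ m z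
  ... | _ , e , u≢z = childSuchThat-satisfies (λ u → ¬? (u ≟ z)) e u≢z

  d : ℕ
  d = rhs E p

  gap : Fin n → ℕ
  gap x = p x ∸ maxℕ (map p (inList E x))

  gap≡ : ∀ {x} → Match E x → gap x ≡ p x ∸ p (heavy x)
  gap≡ {x} m = cong (p x ∸_) (sym (argmax⁺≡maxℕ p x (◁⇒∈inList (proj₂ (Match⇒∃◁ m)))))

  gap≤d : ∀ {x} → Match E x → p x ∸ p (heavy x) ≤ d
  gap≤d m = subst (_≤ d) (gap≡ m) (maxℕ-ub gap (Match⇒∈matchList m))

  0<d⇒∃gap≡d : 0 < d → ∃[ x ] (Match E x × p x ∸ p (heavy x) ≡ d)
  0<d⇒∃gap≡d 0<d with maxℕ-attained gap (matchList E) 0<d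
  ... | x , x∈ , eq = x , m , trans (sym (gap≡ m)) eq
    where m = ∈matchList⇒Match x∈

module LightPlayers {n : ℕ} (E : Digraph n) (T : IsSETournament E)
                    (p : Fin n → ℕ) (p-size : ∀ u → HasSize (PlayerOf E u) (p u)) where
  open HeavyChild E T p p-size public

  infix 4 _∈L_ _∈L?_
  _∈L_ : Fin n → Fin n → Set
  a ∈L x = a ∈P x × ¬ a ∈P heavy x

  _∈L?_ : Decidable _∈L_
  a ∈L? x = a ∈P? x ×-dec ¬? (a ∈P? heavy x)

  light : Fin n → List (Fin n)
  light x = playersOutside (heavy x) x

  length-light≤d : ∀ {x} → Match E x → length (light x) ≤ d
  length-light≤d m = subst (_≤ d) (sym (length-playersOutside (heavy-◁ m))) (gap≤d m)

  ∈L-up : ∀ {a b x y} → Walk E x y → a ∈P x → b ∈L x → a ∈L y → b ∈L y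
  ∈L-up {a} {b} {x} {y} π a∈x b∈L (a∈y , a∉heavy) with unsnocʷ π
  ... | inj₁ refl = b∈L
  ... | inj₂ (v , π′ , e) = ∈P-walk (proj₁ b∈L) π , b∉heavy
    where
    b∉heavy : ¬ b ∈P heavy y
    b∉heavy b∈heavy with heavy y ≟ v
    ... | yes h≡v = a∉heavy (subst (a ∈P_) (sym h≡v) (∈P-walk a∈x π′))
    ... | no h≢v = ∈P-siblings (heavy-◁ (◁⇒Match e)) e h≢v b∈heavy (∈P-walk (proj₁ b∈L) π′)

  private
    lightMatches : Fin n → List (Fin n)
    lightMatches a = filter (λ z → ¬? (isSource? z) ×-dec a ∈L? z) (allFin n)

    -- the match closest to the sink at which a is light
    top : Fin n → Fin n
    top a = argmax⁺ p a (lightMatches a)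

    module _ {a x} (m : Match E x) (a∈L : a ∈L x) where

      x∈lightMatches : x ∈ lightMatches a
      x∈lightMatches = ∈-filter⁺ (λ z → ¬? (isSource? z) ×-dec a ∈L? z) (∈-allFin x) (m , a∈L)

      top-Match×∈L : Match E (top a) × a ∈L top a
      top-Match×∈L = proj₂ (∈-filter⁻ (λ z → ¬? (isSource? z) ×-dec a ∈L? z) {xs = allFin n}
                                      (argmax⁺-∈ p a x∈lightMatches))

      p≤p-top : p x ≤ p (top a)
      p≤p-top = argmax⁺-max p a x∈lightMatches

      Walk-top : Walk E x (top a)
      Walk-top with ∈P-comparable (proj₁ a∈L) (proj₁ (proj₂ top-Match×∈L))
      ... | inj₁ π = π
      ... | inj₂ π with p-walk π
      ...   | inj₁ refl = here
      ...   | inj₂ lt = contradiction p≤p-top (<⇒≱ lt)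

    ∈L-top : ∀ {a b x} → Match E x → a ∈L x → b ∈L x → b ∈L top a
    ∈L-top m a∈L b∈L = ∈L-up (Walk-top m a∈L) (proj₁ a∈L) b∈L (proj₂ (top-Match×∈L m a∈L))

    top-≤ : ∀ {a b x} → Match E x → a ∈L x → b ∈L x → p (top a) ≤ p (top b)
    top-≤ m a∈L b∈L = p≤p-top (proj₁ (top-Match×∈L m a∈L)) (∈L-top m a∈L b∈L)

    top-≡ : ∀ {a b x} → Match E x → a ∈L x → b ∈L x → top a ≡ top b
    top-≡ m a∈L b∈L = ∈P-p-injective (proj₁ (proj₂ (top-Match×∈L m a∈L))) (proj₁ (∈L-top m b∈L a∈L))
                                     (≤-antisym (top-≤ m a∈L b∈L) (top-≤ m b∈L a∈L))

    ∈light-top : ∀ {a x} → Match E x → a ∈L x → a ∈ light (top a)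
    ∈light-top m a∈L = ∈playersOutside⁺ (proj₁ a∈L-top) (proj₂ a∈L-top)
      where a∈L-top = proj₂ (top-Match×∈L m a∈L)

  label : Fin n → ℕ
  label a = position _≟_ a (light (top a))

  label<d : ∀ {a x} → Match E x → a ∈L x → label a < d
  label<d m a∈L = <-≤-trans (position-< _≟_ (∈light-top m a∈L))
                            (length-light≤d (proj₁ (top-Match×∈L m a∈L)))

  label-injective : ∀ {a b x} → Match E x → a ∈L x → b ∈L x → label a ≡ label b → a ≡ b
  label-injective {a} {b} m a∈L b∈L eq = position-injective _≟_ (∈light-top m a∈L) b∈light-top-a
    (trans eq (cong (λ z → position _≟_ b (light z)) top-b≡top-a))
    where
    top-b≡top-a = top-≡ m b∈L a∈L
    b∈light-top-a = subst (λ z → b ∈ light z) top-b≡top-a (∈light-top m b∈L)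

module Brackets {n : ℕ} (E : Digraph n) (T : IsSETournament E)
                (p : Fin n → ℕ) (p-size : ∀ u → HasSize (PlayerOf E u) (p u)) where
  open LightPlayers E T p p-size public

  module ChoiceBracket (ch : Fin n → Fin n) (ch-◁ : ∀ {y} → Match E y → ch y ◁ y) where

    private
      play : ∀ v → WfRec _◁_ (λ _ → Fin n) v → Fin n
      play v rec with isSource? v
      ... | yes _ = v
      ... | no m = rec (ch-◁ m)

      play-ext : ∀ v {rec rec′ : WfRec _◁_ (λ _ → Fin n) v} →
                 (∀ {y} (e : y ◁ v) → rec e ≡ rec′ e) → play v rec ≡ play v rec′
      play-ext v eq with isSource? v
      ... | yes _ = refl
      ... | no m = eq (ch-◁ m)

    bracket : Fin n → Fin n
    bracket = ◁-induction (λ _ → Fin n) play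

    private
      bracket-unfold : ∀ {v} → bracket v ≡ play v (λ _ → bracket _)
      bracket-unfold = WF.FixPoint.unfold-wfRec ◁-wellFounded (λ _ → Fin n) play play-ext

    bracket-source : ∀ {v} → IsSource E v → bracket v ≡ v
    bracket-source {v} src with isSource? v | bracket-unfold {v}
    ... | yes _ | eq = eq
    ... | no m | _ = contradiction src m

    bracket-match : ∀ {v} → Match E v → bracket v ≡ bracket (ch v)
    bracket-match {v} m with isSource? v | bracket-unfold {v}
    ... | yes src | _ = contradiction src m
    ... | no m′ | eq = eq

    bracket-∈P : ∀ v → bracket v ∈P v
    bracket-∈P = ◁-induction (λ v → bracket v ∈P v) extend
      where
      extend : ∀ x → (∀ {y} → y ◁ x → bracket y ∈P y) → bracket x ∈P x
      extend x ih with source⊎match x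
      ... | inj₁ src = subst (_∈P x) (sym (bracket-source src)) (source-∈P src)
      ... | inj₂ m = subst (_∈P x) (sym (bracket-match m)) (∈P-◁ (ih (ch-◁ m)) (ch-◁ m))

    isBracket : IsBracket E bracket
    isBracket = record
      { toPlayer = proj₁ ∘ bracket-∈P
      ; onPlayers = λ _ → bracket-source
      ; onMatches = λ _ m → ch _ , ch-◁ m , bracket-match m
      }

    bracket-reaches : ∀ {a v} → a ∈P v → (∀ {y} → Match E y → Walk E y v → a ∈P y → a ∈P ch y) →
                      bracket v ≡ a
    bracket-reaches {a} {v} = ◁-induction Reaches extend v
      where
      Reaches : Fin n → Set
      Reaches v = a ∈P v → (∀ {y} → Match E y → Walk E y v → a ∈P y → a ∈P ch y) → bracket v ≡ a
      extend : ∀ x → (∀ {y} → y ◁ x → Reaches y) → Reaches x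
      extend x ih a∈x keeps with source⊎match x
      ... | inj₁ src = trans (bracket-source src) (sym (∈P-source src a∈x))
      ... | inj₂ m = trans (bracket-match m) (ih (ch-◁ m) (keeps m here a∈x)
                     (λ m′ π → keeps m′ (π ++ʷ ◁⇒Walk (ch-◁ m))))

  _[_≔_] : (Fin n → Fin n) → Fin n → Fin n → Fin n → Fin n
  (B [ x ≔ a ]) v with v ≟ x
  ... | yes _ = a
  ... | no _ = B v

  update-≡ : ∀ B x a → (B [ x ≔ a ]) x ≡ a
  update-≡ B x a with x ≟ x
  ... | yes _ = refl
  ... | no x≢x = contradiction refl x≢x

  update-≢ : ∀ B {x v} a → v ≢ x → (B [ x ≔ a ]) v ≡ B v
  update-≢ B {x} {v} a v≢x with v ≟ x
  ... | yes v≡x = contradiction v≡x v≢x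
  ... | no _ = refl

  update-isBracket : ∀ {B x u} → IsBracket E B → (∀ {y} → x ◁ y → B y ≢ B x) → u ◁ x →
                     IsBracket E (B [ x ≔ B u ])
  update-isBracket {B} {x} {u} isB winner-stops e = record
    { toPlayer = toPlayer′ ; onPlayers = onPlayers′ ; onMatches = onMatches′ }
    where
    open IsBracket isB
    u≢x : u ≢ x
    u≢x refl = ◁-acyclic e here
    toPlayer′ : ∀ v → Player E ((B [ x ≔ B u ]) v)
    toPlayer′ v with v ≟ x
    ... | yes _ = toPlayer u
    ... | no _ = toPlayer v
    onPlayers′ : ∀ a → Player E a → (B [ x ≔ B u ]) a ≡ a
    onPlayers′ a src = trans (update-≢ B (B u) (λ { refl → ◁⇒Match e src })) (onPlayers a src)
    onMatches′ : ∀ y → Match E y → Σ[ v ∈ Fin n ] (v ◁ y × (B [ x ≔ B u ]) y ≡ (B [ x ≔ B u ]) v)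
    onMatches′ y m with y ≟ x
    ... | yes refl = u , e , sym (update-≢ B (B u) u≢x)
    ... | no _ with onMatches y m
    ...   | v , e′ , By≡Bv with v ≟ x
    ...     | yes refl = contradiction By≡Bv (winner-stops e′)
    ...     | no v≢x = v , e′ , trans By≡Bv (sym (update-≢ B (B u) v≢x))

  module _ {B : Fin n → Fin n} (isB : IsBracket E B) where
    open IsBracket isB

    IsBracket⇒∈P : ∀ v → B v ∈P v
    IsBracket⇒∈P = ◁-induction (λ v → B v ∈P v) extend
      where
      extend : ∀ x → (∀ {y} → y ◁ x → B y ∈P y) → B x ∈P x
      extend x ih with source⊎match x
      ... | inj₁ src = subst (_∈P x) (sym (onPlayers x src)) (source-∈P src)
      ... | inj₂ m with onMatches x m
      ...   | u , e , Bx≡Bu = subst (_∈P x) (sym Bx≡Bu) (∈P-◁ (ih e) e)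

    IsBracket-heavy : ∀ {x} → Match E x → B x ∈P heavy x → B x ≡ B (heavy x)
    IsBracket-heavy {x} m Bx∈heavy with onMatches x m
    ... | u , e , Bx≡Bu with u ≟ heavy x
    ...   | yes refl = Bx≡Bu
    ...   | no u≢heavy = contradiction Bx∈heavy
                           (∈P-siblings e (heavy-◁ m) u≢heavy (subst (_∈P u) (sym Bx≡Bu) (IsBracket⇒∈P u)))

module UpperBound {n : ℕ} (E : Digraph n) (T : IsSETournament E)
                  (p : Fin n → ℕ) (p-size : ∀ u → HasSize (PlayerOf E u) (p u)) where
  open Brackets E T p p-size

  -- The case splits below go through helper functions rather than `with`: abstracting
  -- these decisions out of goals that mention label or Q makes type checking blow up.
  Labelled : Fin d → Fin n → Set
  Labelled i y = Any (λ b → label b ≡ toℕ i) (light y)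

  choiceFrom : ∀ {i y} → Dec (Labelled i y) → Fin n
  choiceFrom {y = y} (yes found) = towards y (proj₁ (find found))
  choiceFrom {y = y} (no _) = heavy y

  labelledChoice : Fin d → Fin n → Fin n
  labelledChoice i y = choiceFrom (Any.any? (λ b → label b ≟ℕ toℕ i) (light y))

  labelledChoice-◁ : ∀ {i y} → Match E y → labelledChoice i y ◁ y
  labelledChoice-◁ {i} {y} m = go (Any.any? (λ b → label b ≟ℕ toℕ i) (light y))
    where
    go : (labelled? : Dec (Labelled i y)) → choiceFrom labelled? ◁ y
    go (yes _) = childSuchThat-◁ _ m
    go (no _) = heavy-◁ m

  labelledChoice-keeps : ∀ {i a y} → Match E y → a ∈P y → label a ≡ toℕ i →
                         (∀ {b} → b ∈L y → label b ≡ toℕ i → b ≡ a) → a ∈P labelledChoice i y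
  labelledChoice-keeps {i} {a} {y} m a∈y la unique = go (Any.any? (λ b → label b ≟ℕ toℕ i) (light y))
    where
    go : (labelled? : Dec (Labelled i y)) → a ∈P choiceFrom labelled?
    go (yes found) = subst (λ b → a ∈P towards y b) (sym (unique (∈playersOutside⁻ b∈light) lb)) (towards-∈P m a∈y)
      where open Σ (proj₂ (find found)) renaming (proj₁ to b∈light; proj₂ to lb)
    go (no none) = decidable-stable (a ∈P? heavy y) (λ a∉heavy → none (lose (∈playersOutside⁺ a∈y a∉heavy) la))

  Q : Fin d → Fin n → Fin n
  Q i = ChoiceBracket.bracket (labelledChoice i) labelledChoice-◁

  Q-isBracket : ∀ i → IsBracket E (Q i)
  Q-isBracket i = ChoiceBracket.isBracket (labelledChoice i) labelledChoice-◁

  Q-label : ∀ {a x} → Match E x → a ∈L x → ∀ i → label a ≡ toℕ i → Q i x ≡ a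
  Q-label m a∈L i la = ChoiceBracket.bracket-reaches (labelledChoice i) labelledChoice-◁ (proj₁ a∈L)
    (λ m′ π a∈y → labelledChoice-keeps m′ a∈y la
       (λ b∈L lb → label-injective m (∈L-up π a∈y b∈L a∈L) a∈L (trans lb (sym la))))

  Q-covers-light : ∀ {a x} → Match E x → a ∈L x → ∃[ i ] Q i x ≡ a
  Q-covers-light m a∈L = i , Q-label m a∈L i (sym (toℕ-fromℕ< (label<d m a∈L)))
    where i = fromℕ< (label<d m a∈L)

  Q-separates : ∀ {B B′} → IsBracket E B → IsBracket E B′ →
                (∀ i {x} → Match E x → Q i x ≡ B x → Q i x ≡ B′ x) →
                (∀ i {x} → Match E x → Q i x ≡ B′ x → Q i x ≡ B x) →
                ∀ v → B v ≡ B′ v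
  Q-separates {B} {B′} isB isB′ B⇒B′ B′⇒B = ◁-induction (λ v → B v ≡ B′ v) extend
    where
    light-winner : ∀ {C C′ x} → IsBracket E C → Match E x → ¬ C x ∈P heavy x →
                   (∀ i → Q i x ≡ C x → Q i x ≡ C′ x) → C x ≡ C′ x
    light-winner {x = x} isC m Cx∉heavy transport = trans (sym Qix≡Cx) (transport i Qix≡Cx)
      where open Σ (Q-covers-light m (IsBracket⇒∈P isC x , Cx∉heavy)) renaming (proj₁ to i; proj₂ to Qix≡Cx)
    extend : ∀ x → (∀ {y} → y ◁ x → B y ≡ B′ y) → B x ≡ B′ x
    extend x ih = [ onSource , onMatch ]′ (source⊎match x)
      where
      onSource : IsSource E x → B x ≡ B′ x
      onSource src = trans (IsBracket.onPlayers isB x src) (sym (IsBracket.onPlayers isB′ x src))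
      onMatch : Match E x → B x ≡ B′ x
      onMatch m = byCases (B x ∈P? heavy x) (B′ x ∈P? heavy x)
        where
        byCases : Dec (B x ∈P heavy x) → Dec (B′ x ∈P heavy x) → B x ≡ B′ x
        byCases (no Bx∉heavy) _ = light-winner {B} {B′} isB m Bx∉heavy (λ i → B⇒B′ i m)
        byCases (yes _) (no B′x∉heavy) = sym (light-winner {B′} {B} isB′ m B′x∉heavy (λ i → B′⇒B i m))
        byCases (yes Bx∈heavy) (yes B′x∈heavy) =
          trans (IsBracket-heavy isB m Bx∈heavy) (trans (ih (heavy-◁ m)) (sym (IsBracket-heavy isB′ m B′x∈heavy)))

module LowerBound {n : ℕ} (E : Digraph n) (T : IsSETournament E)
                  (p : Fin n → ℕ) (p-size : ∀ u → HasSize (PlayerOf E u) (p u))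
                  {k : ℕ} (Bs : Fin k → Fin n → Fin n) where
  open Brackets E T p p-size

  Covered : Fin n → Fin n → Set
  Covered x a = ∃[ i ] Bs i x ≡ a

  Covered? : ∀ x a → Dec (Covered x a)
  Covered? x a = any? (λ i → Bs i x ≟ a)

  Covered⇒length≤k : ∀ {x l} → Unique l → (∀ {a} → a ∈ l → Covered x a) → length l ≤ k
  Covered⇒length≤k {x} {l} u covered =
    ≤-trans (Unique∧⊆⇒length≤ u l⊆winners) (≤-reflexive (length-tabulate (λ i → Bs i x)))
    where
    l⊆winners : l ⊆ List.tabulate (λ i → Bs i x)
    l⊆winners a∈ = subst (_∈ _) (proj₂ (covered a∈)) (∈-tabulate⁺ (proj₁ (covered a∈)))

  uncovered-outside : ∀ {u x} → u ◁ x → k < p x ∸ p u → ∃[ a ] (a ∈P x × ¬ a ∈P u × ¬ Covered x a)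
  uncovered-outside {u} {x} e k<gap with Any.any? (λ a → ¬? (Covered? x a)) (playersOutside u x)
  ... | yes found with find found
  ...   | a , a∈ , uncovered = a , proj₁ (∈playersOutside⁻ a∈) , proj₂ (∈playersOutside⁻ a∈) , uncovered
  uncovered-outside {u} {x} e k<gap | no none = contradiction
        (Covered⇒length≤k (playersOutside-unique u x)
          (λ a∈ → decidable-stable (Covered? x _) (λ uncovered → none (lose a∈ uncovered))))
        (<⇒≱ (subst (k <_) (sym (length-playersOutside e)) k<gap))

  uncovered-child : ∀ {u x} → u ◁ x → k < p x ∸ p u →
                    ∃[ u′ ] (u′ ◁ x × u′ ≢ u × ∃[ a ] (a ∈P u′ × ¬ Covered x a))
  uncovered-child e k<gap with uncovered-outside e k<gap
  ... | a , a∈x , a∉u , uncovered with ∈P-child (◁⇒Match e) a∈x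
  ... | u′ , e′ , a∈u′ = u′ , e′ , (λ { refl → a∉u a∈u′ }) , a , a∈u′ , uncovered

  record UncoveredPair : Set where
    field
      x u₁ u₂ w₁ w₂ : Fin n
      e₁ : u₁ ◁ x
      e₂ : u₂ ◁ x
      u₂≢u₁ : u₂ ≢ u₁
      w₁∈u₁ : w₁ ∈P u₁
      w₂∈u₂ : w₂ ∈P u₂
      w₁-uncovered : ¬ Covered x w₁
      w₂-uncovered : ¬ Covered x w₂

  -- every child u of a match x of maximal gap leaves p x ∸ p u ≥ d > k players of x outside it
  uncoveredPair : k < d → UncoveredPair
  uncoveredPair k<d with 0<d⇒∃gap≡d (≤-<-trans z≤n k<d)
  ... | x , m , gap≡d with uncovered-child (heavy-◁ m) (subst (k <_) (sym gap≡d) k<d)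
  ... | u₁ , e₁ , _ , w₁ , w₁∈u₁ , w₁-uncovered
    with uncovered-child e₁ (<-≤-trans k<d (subst (_≤ p x ∸ p u₁) gap≡d (∸-monoʳ-≤ (p x) (p≤p-heavy e₁))))
  ... | u₂ , e₂ , u₂≢u₁ , w₂ , w₂∈u₂ , w₂-uncovered = record
    { x = x ; u₁ = u₁ ; u₂ = u₂ ; w₁ = w₁ ; w₂ = w₂ ; e₁ = e₁ ; e₂ = e₂ ; u₂≢u₁ = u₂≢u₁
    ; w₁∈u₁ = w₁∈u₁ ; w₂∈u₂ = w₂∈u₂ ; w₁-uncovered = w₁-uncovered ; w₂-uncovered = w₂-uncovered }

  module Indistinguishable (pair : UncoveredPair) where
    open UncoveredPair pair

    -- parents of x avoid x, so that the winner at x can be changed (update-isBracket)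
    baseChoice : Fin n → Fin n
    baseChoice y with x ◁? y | w₁ ∈P? y
    ... | yes _ | _ = avoiding y x
    ... | no _ | yes _ = towards y w₁
    ... | no _ | no _ = towards y w₂

    baseChoice-◁ : ∀ {y} → Match E y → baseChoice y ◁ y
    baseChoice-◁ {y} m with x ◁? y | w₁ ∈P? y
    ... | yes _ | _ = childSuchThat-◁ _ m
    ... | no _ | yes _ = childSuchThat-◁ _ m
    ... | no _ | no _ = childSuchThat-◁ _ m

    baseChoice-parent : ∀ {y} → x ◁ y → baseChoice y ≡ avoiding y x
    baseChoice-parent {y} x◁y with x ◁? y
    ... | yes _ = refl
    ... | no x⋪y = contradiction x◁y x⋪y

    baseChoice-w₁ : ∀ {y} → ¬ x ◁ y → w₁ ∈P y → baseChoice y ≡ towards y w₁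
    baseChoice-w₁ {y} x⋪y w₁∈y with x ◁? y | w₁ ∈P? y
    ... | yes x◁y | _ = contradiction x◁y x⋪y
    ... | no _ | yes _ = refl
    ... | no _ | no w₁∉y = contradiction w₁∈y w₁∉y

    baseChoice-w₂ : ∀ {y} → ¬ x ◁ y → ¬ w₁ ∈P y → baseChoice y ≡ towards y w₂
    baseChoice-w₂ {y} x⋪y w₁∉y with x ◁? y | w₁ ∈P? y
    ... | yes x◁y | _ = contradiction x◁y x⋪y
    ... | no _ | yes w₁∈y = contradiction w₁∈y w₁∉y
    ... | no _ | no _ = refl

    open ChoiceBracket baseChoice baseChoice-◁ renaming (bracket to B₀; isBracket to B₀-isBracket)

    below-child⇒⋪ : ∀ {y u} → u ◁ x → Walk E y u → ¬ x ◁ y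
    below-child⇒⋪ e π x◁y = ◁-acyclic x◁y (π ++ʷ ◁⇒Walk e)

    B₀u₁≡w₁ : B₀ u₁ ≡ w₁
    B₀u₁≡w₁ = bracket-reaches w₁∈u₁ λ m π w₁∈y →
      subst (w₁ ∈P_) (sym (baseChoice-w₁ (below-child⇒⋪ e₁ π) w₁∈y)) (towards-∈P m w₁∈y)

    B₀u₂≡w₂ : B₀ u₂ ≡ w₂
    B₀u₂≡w₂ = bracket-reaches w₂∈u₂ λ m π w₂∈y →
      subst (w₂ ∈P_) (sym (baseChoice-w₂ (below-child⇒⋪ e₂ π) (w₁∉y π))) (towards-∈P m w₂∈y)
      where
      w₁∉y : ∀ {y} → Walk E y u₂ → ¬ w₁ ∈P y
      w₁∉y π w₁∈y = ∈P-siblings e₁ e₂ (≢-sym u₂≢u₁) w₁∈u₁ (∈P-walk w₁∈y π)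

    B₀-winner-stops : ∀ {y} → x ◁ y → B₀ y ≢ B₀ x
    B₀-winner-stops {y} x◁y B₀y≡B₀x =
      ∈P-siblings (childSuchThat-◁ _ m) x◁y (avoiding-≢ m) B₀y∈avoiding (subst (_∈P x) (sym B₀y≡B₀x) (bracket-∈P x))
      where
      m = ◁⇒Match x◁y
      B₀y∈avoiding : B₀ y ∈P avoiding y x
      B₀y∈avoiding = subst (_∈P avoiding y x) (sym (trans (bracket-match m) (cong B₀ (baseChoice-parent x◁y))))
                           (bracket-∈P (avoiding y x))

    B₁ B₂ : Fin n → Fin n
    B₁ = B₀ [ x ≔ B₀ u₁ ]
    B₂ = B₀ [ x ≔ B₀ u₂ ]

    B₁-isBracket : IsBracket E B₁
    B₁-isBracket = update-isBracket B₀-isBracket B₀-winner-stops e₁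

    B₂-isBracket : IsBracket E B₂
    B₂-isBracket = update-isBracket B₀-isBracket B₀-winner-stops e₂

    B₁x≡w₁ : B₁ x ≡ w₁
    B₁x≡w₁ = trans (update-≡ B₀ x (B₀ u₁)) B₀u₁≡w₁

    B₂x≡w₂ : B₂ x ≡ w₂
    B₂x≡w₂ = trans (update-≡ B₀ x (B₀ u₂)) B₀u₂≡w₂

    B₁≢B₂ : ∃[ v ] B₁ v ≢ B₂ v
    B₁≢B₂ = x , λ B₁x≡B₂x → ∈P-siblings e₁ e₂ (≢-sym u₂≢u₁) w₁∈u₁
      (subst (_∈P u₂) (trans (sym B₂x≡w₂) (trans (sym B₁x≡B₂x) B₁x≡w₁)) w₂∈u₂)

    same-agreement : ∀ i → agreement E (Bs i) B₁ ≡ agreement E (Bs i) B₂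
    same-agreement i = tabulate-cong λ y → cong (isMatch E y ∧_) (same-at (y ≟ x))
      where
      ⌊⌋≡false : ∀ {a b : Fin n} → a ≢ b → ⌊ a ≟ b ⌋ ≡ false
      ⌊⌋≡false {a} {b} a≢b = trans (isYes≗does (a ≟ b)) (dec-false (a ≟ b) a≢b)
      same-at : ∀ {y} → Dec (y ≡ x) → ⌊ Bs i y ≟ B₁ y ⌋ ≡ ⌊ Bs i y ≟ B₂ y ⌋
      same-at (yes refl) = trans (⌊⌋≡false (λ eq → w₁-uncovered (i , trans eq B₁x≡w₁)))
                                 (sym (⌊⌋≡false (λ eq → w₂-uncovered (i , trans eq B₂x≡w₂))))
      same-at {y} (no y≢x) = cong (λ b → ⌊ Bs i y ≟ b ⌋) (trans (update-≢ B₀ _ y≢x) (sym (update-≢ B₀ _ y≢x)))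

lemma5p7 : {c ℓ ℓ' : Level} (R : OrderedCommMonoid c ℓ ℓ') {n : ℕ} (E : Digraph n) →
    IsSETournament E →
    (Σ[ a ∈ Fin n ] Σ[ b ∈ Fin n ] (a ≢ b × Player E a × Player E b)) →
    (σ : Fin n → OrderedCommMonoid.Carrier R) →
    Scoring.IsScoring E R σ →
    Scoring.DistinctSubsetSums E R σ →
    (p : Fin n → ℕ) → (∀ u → HasSize (PlayerOf E u) (p u)) →
    Scoring.IsDim E R σ (rhs E p)
lemma5p7 R E T _ σ _ dss p p-size = (Q , Q-resolving) , resolving⇒d≤k
  where
  open Scoring E R using (IsResolving)
  open Agreement R E σ
  open UpperBound E T p p-size using (Q; Q-isBracket; Q-separates)
  open LowerBound E T p p-size using (uncoveredPair; module Indistinguishable)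

  Q-resolving : IsResolving σ (rhs E p) Q
  Q-resolving = resolving-if-agreements-separate dss Q Q-isBracket λ isB isB′ same →
    Q-separates isB isB′ (λ i → agreement-transport (same i)) (λ i → agreement-transport (sym (same i)))

  resolving⇒d≤k : ∀ k Bs → IsResolving σ k Bs → rhs E p ≤ k
  resolving⇒d≤k k Bs resolving = decidable-stable (rhs E p ≤? k) λ d≰k →
    let open Indistinguishable Bs (uncoveredPair Bs (≰⇒> d≰k))
    in ¬resolving-if-agreements-equal resolving B₁-isBracket B₂-isBracket B₁≢B₂ same-agreement
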